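{- If $\varphi\in\mathrm{IHML}$, then there is a regular monitor $m$ that is sound for $[\![\varphi]\!]$ and informative, i.e. $\mathrm{acc}(m,f)$ or $\mathrm{rej}(m,f)$ for some $f\in\mathrm{Act}^\infty$.
   Context: $\mathrm{Act}$ is a finite set of actions, $\mathrm{Act}^\infty=\mathrm{Act}^*\cup\mathrm{Act}^\omega$. Logic $\mu\mathrm{HML}$: $\varphi::=\mathsf{tt}\mid\mathsf{ff}\mid\varphi\lor\varphi\mid\varphi\land\varphi\mid\langle a\rangle\varphi\mid[a]\varphi\mid\min X.\varphi\mid\max X.\varphi\mid X$, interpreted over $\mathrm{Act}^\infty$: $[\![\mathsf{tt}]\!]=\mathrm{Act}^\infty$, $[\![\mathsf{ff}]\!]=\emptyset$, $\lor,\land$ union/intersection, $[\![[a]\varphi]\!]=\{f\mid f=af'\Rightarrow f'\in[\![\varphi]\!]\}$, $[\![\langle a\rangle\varphi]\!]=\{af\mid f\in[\![\varphi]\!]\}$, $\min X$/$\max X$ least/greatest fixpoints (using valuations). Formulae are closed and guarded. $\mathrm{sHML}$: $\varphi::=\mathsf{tt}\mid\mathsf{ff}\mid[a]\varphi\mid\varphi\land\varphi\mid\max X.\varphi\mid X$; $\mathrm{cHML}$: $\varphi::=\mathsf{tt}\mid\mathsf{ff}\mid\langle a\rangle\varphi\mid\varphi\lor\varphi\mid\min X.\varphi\mid X$. $\mathrm{IHML}=\{\varphi_1\land\varphi_2\in\mu\mathrm{HML}\mid\varphi_1\in\mathrm{sHML},\ \mathsf{ff}\text{ occurs in }\varphi_1\}\cup\{\varphi_1\lor\varphi_2\in\mu\mathrm{HML}\mid\varphi_1\in\mathrm{cHML},\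 \mathsf{tt}\text{ occurs in }\varphi_1\}$. Regular monitors: closed terms $m::=v\mid a.m\mid m+m\mid\mathrm{rec}\,x.m\mid x$ with $v\in\{\mathsf{end},\mathsf{no},\mathsf{yes}\}$ and transitions $a.m\xrightarrow{a}m$, $v\xrightarrow{a}v$, $\mathrm{rec}\,x.m\xrightarrow{a}n$ if $m[\mathrm{rec}\,x.m/x]\xrightarrow{a}n$, $m+n\xrightarrow{a}m'$ if $m\xrightarrow{a}m'$ (and symmetrically). For finite $s$, $\mathrm{acc}(m,s)$ ($\mathrm{rej}(m,s)$) iff $m$ reaches $\mathsf{yes}$ ($\mathsf{no}$) via a sequence of transitions labelled $s$; for infinite $t$, iff this holds for some finite prefix of $t$. $m$ is sound for $P$ if $\mathrm{acc}(m,f)\Rightarrow f\in P$ and $\mathrm{rej}(m,f)\Rightarrow f\notin P$. -}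

module Defs where

open import Level using (Level; Lift; lift) renaming (suc to lsuc; zero to lzero)
open import Data.Nat using (ℕ; zero; suc)
open import Data.Fin using (Fin; zero; suc)
open import Data.List using (List; []; _∷_)
open import Data.Product using (Σ; _×_; _,_)
open import Data.Sum using (_⊎_)
open import Data.Unit using (⊤)
open import Data.Empty using (⊥)
open import Relation.Nullary using (¬_)
open import Relation.Binary.PropositionalEquality using (_≡_)

data Trace (A : Set) : Set where
  fin : List A → Trace A
  inf : (ℕ → A) → Trace A

Pred : Set → Set₁
Pred A = Trace A → Set

-- μHML syntax, well-scoped de Bruijn: Form A n has n free variables.
-- Closed formulae are Form A 0.

data Form (A : Set) (n : ℕ) : Set where
  tt ff   : Form A n
  _∨ᶠ_    : Form A n → Form A n → Form A n
  _∧ᶠ_    : Form A n → Form A n → Form A n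
  ⟨_⟩_    : A → Form A n → Form A n
  [_]_    : A → Form A n → Form A n
  minX    : Form A (suc n) → Form A n     -- min X.φ  (X = de Bruijn index 0)
  maxX    : Form A (suc n) → Form A n
  var     : Fin n → Form A n

_▸_ : {X : Set₁} {n : ℕ} → (Fin n → X) → X → Fin (suc n) → X
(ρ ▸ S) zero    = S
(ρ ▸ S) (suc i) = ρ i

Box : {A : Set} → A → (Trace A → Set₁) → Trace A → Set₁
Box a P (fin [])      = Lift _ ⊤
Box a P (fin (b ∷ s)) = b ≡ a → P (fin s)
Box a P (inf t)       = t 0 ≡ a → P (inf (λ k → t (suc k)))

Dia : {A : Set} → A → (Trace A → Set₁) → Trace A → Set₁
Dia a P (fin [])      = Lift _ ⊥
Dia a P (fin (b ∷ s)) = Lift (lsuc lzero) (b ≡ a) × P (fin s)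
Dia a P (inf t)       = Lift (lsuc lzero) (t 0 ≡ a) × P (inf (λ k → t (suc k)))

-- Semantics.  Fixpoints are the Knaster–Tarski least/greatest fixpoints:
-- intersection of all prefixed points / union of all postfixed points
-- (ranging over predicates Trace A → Set).
⟦_⟧ : {A : Set} {n : ℕ} → Form A n → (Fin n → Pred A) → Trace A → Set₁
⟦ tt ⟧ ρ f      = Lift _ ⊤
⟦ ff ⟧ ρ f      = Lift _ ⊥
⟦ φ ∨ᶠ ψ ⟧ ρ f  = ⟦ φ ⟧ ρ f ⊎ ⟦ ψ ⟧ ρ f
⟦ φ ∧ᶠ ψ ⟧ ρ f  = ⟦ φ ⟧ ρ f × ⟦ ψ ⟧ ρ f
⟦ ⟨ a ⟩ φ ⟧ ρ f = Dia a (⟦ φ ⟧ ρ) f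
⟦ [ a ] φ ⟧ ρ f = Box a (⟦ φ ⟧ ρ) f
⟦ minX φ ⟧ ρ f  = (S : Pred _) → (∀ g → ⟦ φ ⟧ (ρ ▸ S) g → S g) → S f
⟦ maxX φ ⟧ ρ f  = Σ (Pred _) λ S → (∀ g → S g → ⟦ φ ⟧ (ρ ▸ S) g) × S f
⟦ var i ⟧ ρ f   = Lift _ (ρ i f)

⟦_⟧₀ : {A : Set} → Form A 0 → Trace A → Set₁
⟦ φ ⟧₀ = ⟦ φ ⟧ (λ ())

Unguarded : {A : Set} {n : ℕ} → Fin n → Form A n → Set
Unguarded i tt        = ⊥
Unguarded i ff        = ⊥
Unguarded i (φ ∨ᶠ ψ)  = Unguarded i φ ⊎ Unguarded i ψ
Unguarded i (φ ∧ᶠ ψ)  = Unguarded i φ ⊎ Unguarded i ψ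
Unguarded i (⟨ a ⟩ φ) = ⊥
Unguarded i ([ a ] φ) = ⊥
Unguarded i (minX φ)  = Unguarded (suc i) φ
Unguarded i (maxX φ)  = Unguarded (suc i) φ
Unguarded i (var j)   = i ≡ j

Guarded : {A : Set} {n : ℕ} → Form A n → Set
Guarded tt        = ⊤
Guarded ff        = ⊤
Guarded (φ ∨ᶠ ψ)  = Guarded φ × Guarded ψ
Guarded (φ ∧ᶠ ψ)  = Guarded φ × Guarded ψ
Guarded (⟨ a ⟩ φ) = Guarded φ
Guarded ([ a ] φ) = Guarded φ
Guarded (minX φ)  = Guarded φ × ¬ Unguarded zero φ
Guarded (maxX φ)  = Guarded φ × ¬ Unguarded zero φ
Guarded (var j)   = ⊤

data IsSHML {A : Set} {n : ℕ} : Form A n → Set where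
  tt  : IsSHML tt
  ff  : IsSHML ff
  box : ∀ {a φ} → IsSHML φ → IsSHML ([ a ] φ)
  and : ∀ {φ ψ} → IsSHML φ → IsSHML ψ → IsSHML (φ ∧ᶠ ψ)
  max : ∀ {φ} → IsSHML φ → IsSHML (maxX φ)
  var : ∀ {i} → IsSHML (var i)

data IsCHML {A : Set} {n : ℕ} : Form A n → Set where
  tt  : IsCHML tt
  ff  : IsCHML ff
  dia : ∀ {a φ} → IsCHML φ → IsCHML (⟨ a ⟩ φ)
  or  : ∀ {φ ψ} → IsCHML φ → IsCHML ψ → IsCHML (φ ∨ᶠ ψ)
  min : ∀ {φ} → IsCHML φ → IsCHML (minX φ)
  var : ∀ {i} → IsCHML (var i)

data OccursFF {A : Set} {n : ℕ} : Form A n → Set where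
  here : OccursFF ff
  ∨ˡ   : ∀ {φ ψ} → OccursFF φ → OccursFF (φ ∨ᶠ ψ)
  ∨ʳ   : ∀ {φ ψ} → OccursFF ψ → OccursFF (φ ∨ᶠ ψ)
  ∧ˡ   : ∀ {φ ψ} → OccursFF φ → OccursFF (φ ∧ᶠ ψ)
  ∧ʳ   : ∀ {φ ψ} → OccursFF ψ → OccursFF (φ ∧ᶠ ψ)
  dia  : ∀ {a φ} → OccursFF φ → OccursFF (⟨ a ⟩ φ)
  box  : ∀ {a φ} → OccursFF φ → OccursFF ([ a ] φ)
  min  : ∀ {φ} → OccursFF φ → OccursFF (minX φ)
  max  : ∀ {φ} → OccursFF φ → OccursFF (maxX φ)

data OccursTT {A : Set} {n : ℕ} : Form A n → Set where
  here : OccursTT tt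
  ∨ˡ   : ∀ {φ ψ} → OccursTT φ → OccursTT (φ ∨ᶠ ψ)
  ∨ʳ   : ∀ {φ ψ} → OccursTT ψ → OccursTT (φ ∨ᶠ ψ)
  ∧ˡ   : ∀ {φ ψ} → OccursTT φ → OccursTT (φ ∧ᶠ ψ)
  ∧ʳ   : ∀ {φ ψ} → OccursTT ψ → OccursTT (φ ∧ᶠ ψ)
  dia  : ∀ {a φ} → OccursTT φ → OccursTT (⟨ a ⟩ φ)
  box  : ∀ {a φ} → OccursTT φ → OccursTT ([ a ] φ)
  min  : ∀ {φ} → OccursTT φ → OccursTT (minX φ)
  max  : ∀ {φ} → OccursTT φ → OccursTT (maxX φ)

-- IHML (for closed formulae; closedness/guardedness are separate hypotheses)
data IHML {A : Set} : Form A 0 → Set where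
  conj : ∀ {φ₁ φ₂} → IsSHML φ₁ → OccursFF φ₁ → IHML (φ₁ ∧ᶠ φ₂)
  disj : ∀ {φ₁ φ₂} → IsCHML φ₁ → OccursTT φ₁ → IHML (φ₁ ∨ᶠ φ₂)

-- Regular monitors, well-scoped de Bruijn; regular monitors = Mon A 0.

data Mon (A : Set) (n : ℕ) : Set where
  end no yes : Mon A n
  _·_   : A → Mon A n → Mon A n
  _⊕_   : Mon A n → Mon A n → Mon A n
  rec   : Mon A (suc n) → Mon A n
  mvar  : Fin n → Mon A n

ext : {n k : ℕ} → (Fin n → Fin k) → Fin (suc n) → Fin (suc k)
ext r zero    = zero
ext r (suc i) = suc (r i)

rename : {A : Set} {n k : ℕ} → (Fin n → Fin k) → Mon A n → Mon A k
rename r end      = end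
rename r no       = no
rename r yes      = yes
rename r (a · m)  = a · rename r m
rename r (m ⊕ m') = rename r m ⊕ rename r m'
rename r (rec m)  = rec (rename (ext r) m)
rename r (mvar i) = mvar (r i)

exts : {A : Set} {n k : ℕ} → (Fin n → Mon A k) → Fin (suc n) → Mon A (suc k)
exts σ zero    = mvar zero
exts σ (suc i) = rename suc (σ i)

subst : {A : Set} {n k : ℕ} → (Fin n → Mon A k) → Mon A n → Mon A k
subst σ end      = end
subst σ no       = no
subst σ yes      = yes
subst σ (a · m)  = a · subst σ m
subst σ (m ⊕ m') = subst σ m ⊕ subst σ m'
subst σ (rec m)  = rec (subst (exts σ) m)
subst σ (mvar i) = σ i

_[_] : {A : Set} {n : ℕ} → Mon A (suc n) → Mon A n → Mon A n
m [ n ] = subst (λ { zero → n ; (suc i) → mvar i }) m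

data _─_⟶_ {A : Set} : Mon A 0 → A → Mon A 0 → Set where
  act  : ∀ {a m} → (a · m) ─ a ⟶ m
  vend : ∀ {a} → end ─ a ⟶ end
  vno  : ∀ {a} → no ─ a ⟶ no
  vyes : ∀ {a} → yes ─ a ⟶ yes
  rec⟶ : ∀ {a m n} → (m [ rec m ]) ─ a ⟶ n → rec m ─ a ⟶ n
  sumˡ : ∀ {a m m' n} → m ─ a ⟶ m' → (m ⊕ n) ─ a ⟶ m'
  sumʳ : ∀ {a m n n'} → n ─ a ⟶ n' → (m ⊕ n) ─ a ⟶ n'

data _─_⟶*_ {A : Set} : Mon A 0 → List A → Mon A 0 → Set where
  []  : ∀ {m} → m ─ [] ⟶* m
  _∷_ : ∀ {m a s m' m''} → m ─ a ⟶ m' → m' ─ s ⟶* m'' → m ─ (a ∷ s) ⟶* m''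

prefix : {A : Set} → (ℕ → A) → ℕ → List A
prefix t zero    = []
prefix t (suc k) = t 0 ∷ prefix (λ i → t (suc i)) k

acc : {A : Set} → Mon A 0 → Trace A → Set
acc m (fin s) = m ─ s ⟶* yes
acc m (inf t) = Σ ℕ λ k → m ─ prefix t k ⟶* yes

rej : {A : Set} → Mon A 0 → Trace A → Set
rej m (fin s) = m ─ s ⟶* no
rej m (inf t) = Σ ℕ λ k → m ─ prefix t k ⟶* no

Sound : {A : Set} → Mon A 0 → (Trace A → Set₁) → Set₁
Sound m P = ∀ f → (acc m f → P f) × (rej m f → ¬ P f)

Informative : {A : Set} → Mon A 0 → Set
Informative m = Σ (Trace _) λ f → acc m f ⊎ rej m f

-- An sHML formula in which ff occurs contains a path of boxes [a₁]…[aₙ] leading to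
-- that ff, so it is violated by every trace extending a₁…aₙ; the monitor
-- a₁.…aₙ.no therefore only rejects violating traces, never accepts, and rejects
-- a₁…aₙ itself.  Dually, a path of diamonds to an occurrence of tt in a cHML
-- formula yields the sound monitor a₁.…aₙ.yes.  For IHML it suffices to do this
-- for the first conjunct (resp. disjunct).
module Submission where

open import Defs
open import Data.Nat using (ℕ; zero; suc)
open import Data.Fin using (Fin)
open import Data.Product using (Σ; _×_; _,_; proj₁; proj₂)
open import Data.Sum using (inj₁; inj₂)
open import Data.List using (List; []; _∷_)
open import Data.Unit using (⊤; tt)
open import Data.Empty using (⊥; ⊥-elim)
open import Level using (lift; lower)
open import Relation.Nullary using (¬_)
open import Relation.Binary.PropositionalEquality using (_≡_; refl)

module _ {A : Set} where

  infix 4 _≼_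

  _≼_ : List A → Trace A → Set
  []      ≼ f             = ⊤
  (a ∷ s) ≼ fin []        = ⊥
  (a ∷ s) ≼ fin (b ∷ r)   = b ≡ a × s ≼ fin r
  (a ∷ s) ≼ inf t         = t 0 ≡ a × s ≼ inf (λ k → t (suc k))

  ≼-prefix : ∀ s (t : ℕ → A) k → s ≼ fin (prefix t k) → s ≼ inf t
  ≼-prefix []      t k       _          = tt
  ≼-prefix (a ∷ s) t zero    ()
  ≼-prefix (a ∷ s) t (suc k) (eq , s≼) = eq , ≼-prefix s (λ i → t (suc i)) k s≼

  path : List A → Mon A 0 → Mon A 0
  path []      v = v
  path (a ∷ s) v = a · path s v

  path-runs : ∀ s v → path s v ─ s ⟶* v
  path-runs []      v = []
  path-runs (a ∷ s) v = act ∷ path-runs s v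

  data IsVerdict : Mon A 0 → Set where
    no  : IsVerdict no
    yes : IsVerdict yes

  verdict-stuck : ∀ {v r m} → IsVerdict v → v ─ r ⟶* m → m ≡ v
  verdict-stuck V       []          = refl
  verdict-stuck no      (vno ∷ d)   = verdict-stuck no d
  verdict-stuck yes     (vyes ∷ d)  = verdict-stuck yes d

  path-reaches-verdict : ∀ {v w} → IsVerdict v → IsVerdict w →
                         ∀ s {r} → path s v ─ r ⟶* w → s ≼ fin r × w ≡ v
  path-reaches-verdict V W []      d         = tt , verdict-stuck V d
  path-reaches-verdict V () (a ∷ s) []
  path-reaches-verdict V W (a ∷ s) (act ∷ d) =
    let s≼r , w≡v = path-reaches-verdict V W s d in (refl , s≼r) , w≡v

  path-acc : ∀ {v} → IsVerdict v → ∀ s f → acc (path s v) f → s ≼ f × yes ≡ v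
  path-acc V s (fin r) d       = path-reaches-verdict V yes s d
  path-acc V s (inf t) (k , d) =
    let s≼ , yes≡v = path-reaches-verdict V yes s d in ≼-prefix s t k s≼ , yes≡v

  path-rej : ∀ {v} → IsVerdict v → ∀ s f → rej (path s v) f → s ≼ f × no ≡ v
  path-rej V s (fin r) d       = path-reaches-verdict V no s d
  path-rej V s (inf t) (k , d) =
    let s≼ , no≡v = path-reaches-verdict V no s d in ≼-prefix s t k s≼ , no≡v

  path-no-sound : ∀ {P : Trace A → Set₁} s → (∀ f → s ≼ f → ¬ P f) → Sound (path s no) P
  path-no-sound s violated f =
      (λ d → ⊥-elim (yes≢no (proj₂ (path-acc no s f d))))
    , (λ d → violated f (proj₁ (path-rej no s f d)))
    where
    yes≢no : ¬ _≡_ {A = Mon A 0} yes no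
    yes≢no ()

  path-yes-sound : ∀ {P : Trace A → Set₁} s → (∀ f → s ≼ f → P f) → Sound (path s yes) P
  path-yes-sound s satisfied f =
      (λ d → satisfied f (proj₁ (path-acc yes s f d)))
    , (λ d → ⊥-elim (no≢yes (proj₂ (path-rej yes s f d))))
    where
    no≢yes : ¬ _≡_ {A = Mon A 0} no yes
    no≢yes ()

  sHML-violating-prefix : ∀ {n} {φ : Form A n} → IsSHML φ → OccursFF φ →
                          Σ (List A) λ s → ∀ ρ f → s ≼ f → ¬ ⟦ φ ⟧ ρ f
  sHML-violating-prefix ff here = [] , λ _ _ _ → lower
  sHML-violating-prefix (box {a = a} {φ} S) (box o) =
    let s , violated = sHML-violating-prefix S o in a ∷ s , violated-after-a s violated
    where
    violated-after-a : ∀ s → (∀ ρ f → s ≼ f → ¬ ⟦ φ ⟧ ρ f) →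
                       ∀ ρ f → a ∷ s ≼ f → ¬ ⟦ [ a ] φ ⟧ ρ f
    violated-after-a s violated ρ (fin (b ∷ r)) (b≡a , s≼) sat = violated ρ (fin r) s≼ (sat b≡a)
    violated-after-a s violated ρ (inf t)       (t0≡a , s≼) sat =
      violated ρ (inf (λ k → t (suc k))) s≼ (sat t0≡a)
  sHML-violating-prefix (and S _) (∧ˡ o) =
    let s , violated = sHML-violating-prefix S o in s , λ ρ f s≼ sat → violated ρ f s≼ (proj₁ sat)
  sHML-violating-prefix (and _ S) (∧ʳ o) =
    let s , violated = sHML-violating-prefix S o in s , λ ρ f s≼ sat → violated ρ f s≼ (proj₂ sat)
  sHML-violating-prefix (max S) (max o) =
    let s , violated = sHML-violating-prefix S o
    in s , λ { ρ f s≼ (P , post , Pf) → violated (ρ ▸ P) f s≼ (post f Pf) }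

  cHML-satisfying-prefix : ∀ {n} {φ : Form A n} → IsCHML φ → OccursTT φ →
                           Σ (List A) λ s → ∀ ρ f → s ≼ f → ⟦ φ ⟧ ρ f
  cHML-satisfying-prefix tt here = [] , λ _ _ _ → lift tt
  cHML-satisfying-prefix (dia {a = a} {φ} S) (dia o) =
    let s , satisfied = cHML-satisfying-prefix S o in a ∷ s , satisfied-after-a s satisfied
    where
    satisfied-after-a : ∀ s → (∀ ρ f → s ≼ f → ⟦ φ ⟧ ρ f) →
                        ∀ ρ f → a ∷ s ≼ f → ⟦ ⟨ a ⟩ φ ⟧ ρ f
    satisfied-after-a s satisfied ρ (fin (b ∷ r)) (b≡a , s≼) = lift b≡a , satisfied ρ (fin r) s≼
    satisfied-after-a s satisfied ρ (inf t)       (t0≡a , s≼) =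
      lift t0≡a , satisfied ρ (inf (λ k → t (suc k))) s≼
  cHML-satisfying-prefix (or S _) (∨ˡ o) =
    let s , satisfied = cHML-satisfying-prefix S o in s , λ ρ f s≼ → inj₁ (satisfied ρ f s≼)
  cHML-satisfying-prefix (or _ S) (∨ʳ o) =
    let s , satisfied = cHML-satisfying-prefix S o in s , λ ρ f s≼ → inj₂ (satisfied ρ f s≼)
  cHML-satisfying-prefix (min S) (min o) =
    let s , satisfied = cHML-satisfying-prefix S o
    in s , λ ρ f s≼ P pre → pre f (satisfied (ρ ▸ P) f s≼)

lemma9 : (k : ℕ) (φ : Form (Fin k) 0) → Guarded φ → IHML φ →
    Σ (Mon (Fin k) 0) λ m → Sound m ⟦ φ ⟧₀ × Informative m
lemma9 k (φ₁ ∧ᶠ φ₂) _ (conj S o) =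
  let s , violated = sHML-violating-prefix S o
  in path s no
   , path-no-sound s (λ f s≼ sat → violated _ f s≼ (proj₁ sat))
   , (fin s , inj₂ (path-runs s no))
lemma9 k (φ₁ ∨ᶠ φ₂) _ (disj S o) =
  let s , satisfied = cHML-satisfying-prefix S o
  in path s yes
   , path-yes-sound s (λ f s≼ → inj₁ (satisfied _ f s≼))
   , (fin s , inj₁ (path-runs s yes))
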